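{- If a formula $\varphi(x)$ is logically equivalent to $ST(i,x)$ for some intuitionistic propositional formula $i$, then $\varphi(x)$ is invariant with respect to asimulations.
   Context: Formulas are formulas of classical first-order logic with identity in the vocabulary $\Sigma=\{R,P_1,P_2,\dots\}$, $R$ binary, each $P_n$ unary; $\Sigma_\varphi=\{R\}\cup\{P_i: P_i\text{ occurs in }\varphi\}$; $\varphi(x)$ denotes a formula whose only free variable (if any) is $x$. A pointed model is $(M,a)$ with $a\in D(M)$; $M,a\models\varphi(x)$ means $\varphi$ holds in $M$ under assignments sending $x$ to $a$. Standard $x$-translation: $ST(p_n,x)=P_n(x)$; $ST(\bot,x)=(x\neq x)$; $ST(i\wedge j,x)=ST(i,x)\wedge ST(j,x)$; $ST(i\vee j,x)=ST(i,x)\vee ST(j,x)$; $ST(i\to j,x)=\forall y(R(x,y)\to(ST(i,y)\to ST(j,y)))$, $y$ fresh. Asimulation: for $R\in\Sigma'\subseteq\Sigma$ and pointed $\Sigma'$-models $(M,a),(N,b)$, a relation $A\subseteq(D(M)\times D(N))\cup(D(N)\times D(M))$ is an $\langle(M,a),(N,b)\rangle$-asimulation iff $aAb$ and for all $\alpha,\beta\in\{M,N\}$, $a'\in D(\alpha)$, $b'\in D(\beta)$ with $a'Ab'$: (1) for every unary $P\in\Sigma'$, $\alpha,a'\models P(x)$ implies $\beta,b'\models P(x)$; (2) if $b''\in D(\beta)$ and $b'R^\beta b''$ then some $a''\in D(\alpha)$ has $a'R^\alpha a''$, $b''Aa''$ and $a''Ab''$. $\varphi(x)$ is invariant with respect to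 asimulations iff for every $\Sigma'$ with $\Sigma_\varphi\subseteq\Sigma'\subseteq\Sigma$ and all pointed $\Sigma'$-models $(M,a),(N,b)$, if an $\langle(M,a),(N,b)\rangle$-asimulation exists and $M,a\models\varphi(x)$, then $N,b\models\varphi(x)$. -}

module Defs where

open import Data.Nat using (ℕ; suc; _≡ᵇ_)
open import Data.Bool using (Bool; true; false; T; if_then_else_)
open import Data.Unit using (⊤; tt)
open import Data.Empty using (⊥)
open import Data.Product using (Σ; Σ-syntax; _×_; _,_)
open import Data.Sum using (_⊎_)
open import Relation.Binary.PropositionalEquality using (_≡_)
open import Relation.Nullary using (¬_)
open import Function.Bundles using (_⇔_)

Var : Set
Var = ℕ

infixr 6 _∧'_
infixr 5 _∨'_
infixr 4 _⇒'_

data Fm : Set where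
  R'   : Var → Var → Fm
  P'   : ℕ → Var → Fm
  _≐_  : Var → Var → Fm
  ⊥'   : Fm
  ¬'   : Fm → Fm
  _∧'_ : Fm → Fm → Fm
  _∨'_ : Fm → Fm → Fm
  _⇒'_ : Fm → Fm → Fm
  ∀'   : Var → Fm → Fm
  ∃'   : Var → Fm → Fm

FreeIn : Var → Fm → Set
FreeIn z (R' x y)  = z ≡ x ⊎ z ≡ y
FreeIn z (P' n x)  = z ≡ x
FreeIn z (x ≐ y)   = z ≡ x ⊎ z ≡ y
FreeIn z ⊥'        = ⊥
FreeIn z (¬' φ)    = FreeIn z φ
FreeIn z (φ ∧' ψ)  = FreeIn z φ ⊎ FreeIn z ψ
FreeIn z (φ ∨' ψ)  = FreeIn z φ ⊎ FreeIn z ψ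
FreeIn z (φ ⇒' ψ)  = FreeIn z φ ⊎ FreeIn z ψ
FreeIn z (∀' y φ)  = ¬ (z ≡ y) × FreeIn z φ
FreeIn z (∃' y φ)  = ¬ (z ≡ y) × FreeIn z φ

OnlyFree : Var → Fm → Set
OnlyFree x φ = ∀ z → FreeIn z φ → z ≡ x

-- Sub-vocabularies Σ' with R ∈ Σ' ⊆ Σ: given by which P_n belong to Σ'.

Sig : Set
Sig = ℕ → Bool

FullSig : Sig
FullSig _ = true

InVoc : Sig → Fm → Set
InVoc S (R' x y)  = ⊤
InVoc S (P' n x)  = T (S n)
InVoc S (x ≐ y)   = ⊤
InVoc S ⊥'        = ⊤
InVoc S (¬' φ)    = InVoc S φ
InVoc S (φ ∧' ψ)  = InVoc S φ × InVoc S ψ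
InVoc S (φ ∨' ψ)  = InVoc S φ × InVoc S ψ
InVoc S (φ ⇒' ψ)  = InVoc S φ × InVoc S ψ
InVoc S (∀' y φ)  = InVoc S φ
InVoc S (∃' y φ)  = InVoc S φ

inFull : (φ : Fm) → InVoc FullSig φ
inFull (R' x y)  = tt
inFull (P' n x)  = tt
inFull (x ≐ y)   = tt
inFull ⊥'        = tt
inFull (¬' φ)    = inFull φ
inFull (φ ∧' ψ)  = inFull φ , inFull ψ
inFull (φ ∨' ψ)  = inFull φ , inFull ψ
inFull (φ ⇒' ψ)  = inFull φ , inFull ψ
inFull (∀' y φ)  = inFull φ
inFull (∃' y φ)  = inFull φ

record Structure (S : Sig) : Set₁ where
  field
    D   : Set
    Rel : D → D → Set
    Pr  : (n : ℕ) → T (S n) → D → Set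
open Structure public

_[_↦_] : {D : Set} → (Var → D) → Var → D → (Var → D)
(ρ [ y ↦ d ]) z = if z ≡ᵇ y then d else ρ z

Sat : {S : Sig} (M : Structure S) (φ : Fm) → InVoc S φ → (Var → D M) → Set
Sat M (R' x y) h ρ = Rel M (ρ x) (ρ y)
Sat M (P' n x) h ρ = Pr M n h (ρ x)
Sat M (x ≐ y)  h ρ = ρ x ≡ ρ y
Sat M ⊥'       h ρ = ⊥
Sat M (¬' φ)   h ρ = ¬ Sat M φ h ρ
Sat M (φ ∧' ψ) (h , k) ρ = Sat M φ h ρ × Sat M ψ k ρ
Sat M (φ ∨' ψ) (h , k) ρ = Sat M φ h ρ ⊎ Sat M ψ k ρ
Sat M (φ ⇒' ψ) (h , k) ρ = Sat M φ h ρ → Sat M ψ k ρ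
Sat M (∀' y φ) h ρ = (d : D M) → Sat M φ h (ρ [ y ↦ d ])
Sat M (∃' y φ) h ρ = Σ[ d ∈ D M ] Sat M φ h (ρ [ y ↦ d ])

PSat : {S : Sig} (M : Structure S) → D M → (φ : Fm) → Var → InVoc S φ → Set
PSat M a φ x h = (ρ : Var → D M) → ρ x ≡ a → Sat M φ h ρ

LogEquiv : Fm → Fm → Set₁
LogEquiv φ ψ = (M : Structure FullSig) (ρ : Var → D M) →
  Sat M φ (inFull φ) ρ ⇔ Sat M ψ (inFull ψ) ρ

data IFm : Set where
  var  : ℕ → IFm
  ⊥ᵢ   : IFm
  _∧ᵢ_ : IFm → IFm → IFm
  _∨ᵢ_ : IFm → IFm → IFm
  _→ᵢ_ : IFm → IFm → IFm

-- ST(i , x); for implication the bound variable y := suc x is fresh,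
-- since ST(i , x) has no free variable other than x.
ST : IFm → Var → Fm
ST (var n)  x = P' n x
ST ⊥ᵢ       x = ¬' (x ≐ x)
ST (i ∧ᵢ j) x = ST i x ∧' ST j x
ST (i ∨ᵢ j) x = ST i x ∨' ST j x
ST (i →ᵢ j) x = ∀' (suc x) (R' x (suc x) ⇒' (ST i (suc x) ⇒' ST j (suc x)))

-- Asimulations.  A ⊆ (D(M)×D(N)) ∪ (D(N)×D(M)) is given by its two parts
-- A₁₂ ⊆ D(M)×D(N) and A₂₁ ⊆ D(N)×D(M).

AsimCond : {S : Sig} (M₁ M₂ : Structure S) →
  (D M₁ → D M₂ → Set) → (D M₂ → D M₁ → Set) → Set
AsimCond {S} M₁ M₂ A₁₂ A₂₁ =
  (a' : D M₁) (b' : D M₂) → A₁₂ a' b' →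
    ((n : ℕ) (h : T (S n)) → Pr M₁ n h a' → Pr M₂ n h b')
    × ((b'' : D M₂) → Rel M₂ b' b'' →
         Σ[ a'' ∈ D M₁ ] (Rel M₁ a' a'' × A₂₁ b'' a'' × A₁₂ a'' b''))

IsAsim : {S : Sig} (M N : Structure S) (a : D M) (b : D N) →
  (D M → D N → Set) → (D N → D M → Set) → Set
IsAsim M N a b AMN ANM =
  AMN a b × AsimCond M N AMN ANM × AsimCond N M ANM AMN

AsimExists : {S : Sig} (M N : Structure S) (a : D M) (b : D N) → Set₁
AsimExists M N a b =
  Σ[ AMN ∈ (D M → D N → Set) ] Σ[ ANM ∈ (D N → D M → Set) ] IsAsim M N a b AMN ANM

InvariantAsim : Fm → Var → Set₁
InvariantAsim φ x =
  (S : Sig) (h : InVoc S φ) (M N : Structure S) (a : D M) (b : D N) →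
  AsimExists M N a b → PSat M a φ x h → PSat N b φ x h

module Submission where

open import Defs
open import Data.Nat using (suc; _≡ᵇ_)
open import Data.Nat.Properties using (≡ᵇ⇒≡; ≡⇒≡ᵇ; 1+n≢n)
open import Data.Bool using (true; false; T)
open import Data.Bool.Properties using (T-irrelevant)
open import Data.Unit using (tt)
open import Data.Empty using (⊥; ⊥-elim)
open import Data.Product using (Σ; _×_; _,_; proj₁; proj₂)
open import Data.Product.Function.NonDependent.Propositional using (_×-⇔_)
open import Data.Sum using (_⊎_; inj₁; inj₂)
open import Data.Sum.Function.Propositional using (_⊎-⇔_)
open import Function.Bundles using (_⇔_; mk⇔; Equivalence)
open import Function.Properties.Equivalence using () renaming (refl to ⇔-refl; trans to ⇔-trans)
open import Function.Related.TypeIsomorphisms using (→-cong-⇔; ¬-cong-⇔)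
open import Relation.Binary.PropositionalEquality
  using (_≡_; _≢_; ≢-sym; refl; sym; subst; subst₂)

-- ST(i , x) says exactly that x forces i in the Kripke model
-- (D, R), read with R as accessibility and the P_n as valuations.  Forcing
-- is transferred along an asimulation by induction on i: atoms by (1), and
-- for i → j a successor b'' of b' is matched by a successor a'' of a' with
-- b'' A a'' (carrying i back from N to M) and a'' A b'' (carrying j
-- forward).  A formula equivalent to ST(i , x) inherits this invariance.

[↦]-same : {A : Set} (ρ : Var → A) (y : Var) (d : A) → (ρ [ y ↦ d ]) y ≡ d
[↦]-same ρ y d with y ≡ᵇ y in eq
... | true  = refl
... | false = ⊥-elim (subst T eq (≡⇒≡ᵇ y y refl))

[↦]-other : {A : Set} (ρ : Var → A) {y z : Var} (d : A) → z ≢ y →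
  (ρ [ y ↦ d ]) z ≡ ρ z
[↦]-other ρ {y} {z} d z≢y with z ≡ᵇ y in eq
... | true  = ⊥-elim (z≢y (≡ᵇ⇒≡ z y (subst T (sym eq) tt)))
... | false = refl

-- LogEquiv only speaks of Σ-models, so a Σ'-model is extended by
-- interpreting the predicates P_n with n ∉ Σ' as empty.
extend : {S : Sig} → Structure S → Structure FullSig
extend {S} M = record
  { D   = D M
  ; Rel = Rel M
  ; Pr  = λ n _ d → Σ (T (S n)) λ h → Pr M n h d
  }

Sat-extend : {S : Sig} (M : Structure S) (φ : Fm) (h : InVoc S φ) (ρ : Var → D M) →
  Sat M φ h ρ ⇔ Sat (extend M) φ (inFull φ) ρ
Sat-extend M (R' x y) h ρ = ⇔-refl
Sat-extend M (P' n x) h ρ = mk⇔ (h ,_) λ (h′ , p) →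
  subst (λ k → Pr M n k (ρ x)) (T-irrelevant h′ h) p
Sat-extend M (x ≐ y) h ρ = ⇔-refl
Sat-extend M ⊥' h ρ = ⇔-refl
Sat-extend M (¬' φ) h ρ = ¬-cong-⇔ (Sat-extend M φ h ρ)
Sat-extend M (φ ∧' ψ) (h , k) ρ = Sat-extend M φ h ρ ×-⇔ Sat-extend M ψ k ρ
Sat-extend M (φ ∨' ψ) (h , k) ρ = Sat-extend M φ h ρ ⊎-⇔ Sat-extend M ψ k ρ
Sat-extend M (φ ⇒' ψ) (h , k) ρ = →-cong-⇔ (Sat-extend M φ h ρ) (Sat-extend M ψ k ρ)
Sat-extend M (∀' y φ) h ρ = mk⇔
  (λ f d → Equivalence.to   (Sat-extend M φ h (ρ [ y ↦ d ])) (f d))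
  (λ f d → Equivalence.from (Sat-extend M φ h (ρ [ y ↦ d ])) (f d))
Sat-extend M (∃' y φ) h ρ = mk⇔
  (λ (d , p) → d , Equivalence.to   (Sat-extend M φ h (ρ [ y ↦ d ])) p)
  (λ (d , p) → d , Equivalence.from (Sat-extend M φ h (ρ [ y ↦ d ])) p)

AsimCond-extend : {S : Sig} {M₁ M₂ : Structure S}
  {A₁₂ : D M₁ → D M₂ → Set} {A₂₁ : D M₂ → D M₁ → Set} →
  AsimCond M₁ M₂ A₁₂ A₂₁ → AsimCond (extend M₁) (extend M₂) A₁₂ A₂₁
AsimCond-extend cond a b ab =
  (λ n _ (h , p) → h , proj₁ (cond a b ab) n h p) , proj₂ (cond a b ab)

Forces : (M : Structure FullSig) → D M → IFm → Set
Forces M d (var n)  = Pr M n tt d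
Forces M d ⊥ᵢ       = ⊥
Forces M d (i ∧ᵢ j) = Forces M d i × Forces M d j
Forces M d (i ∨ᵢ j) = Forces M d i ⊎ Forces M d j
Forces M d (i →ᵢ j) = (e : D M) → Rel M d e → Forces M e i → Forces M e j

Sat-ST : (M : Structure FullSig) (i : IFm) (x : Var) (ρ : Var → D M) →
  Sat M (ST i x) (inFull (ST i x)) ρ ⇔ Forces M (ρ x) i
Sat-ST M (var n)  x ρ = ⇔-refl
Sat-ST M ⊥ᵢ       x ρ = mk⇔ (λ x≢x → x≢x refl) λ ()
Sat-ST M (i ∧ᵢ j) x ρ = Sat-ST M i x ρ ×-⇔ Sat-ST M j x ρ
Sat-ST M (i ∨ᵢ j) x ρ = Sat-ST M i x ρ ⊎-⇔ Sat-ST M j x ρ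
Sat-ST M (i →ᵢ j) x ρ = mk⇔
  (λ f e r → Equivalence.to   (successor e) (f e (Rel-update⁻ r)))
  (λ f e r → Equivalence.from (successor e) (f e (Rel-update r)))
  where
    ρ[_] : D M → Var → D M
    ρ[ e ] = ρ [ suc x ↦ e ]

    x-unchanged : (e : D M) → ρ[ e ] x ≡ ρ x
    x-unchanged e = [↦]-other ρ e (≢-sym 1+n≢n)

    Rel-update : {e : D M} → Rel M (ρ[ e ] x) (ρ[ e ] (suc x)) → Rel M (ρ x) e
    Rel-update {e} = subst₂ (Rel M) (x-unchanged e) ([↦]-same ρ (suc x) e)

    Rel-update⁻ : {e : D M} → Rel M (ρ x) e → Rel M (ρ[ e ] x) (ρ[ e ] (suc x))
    Rel-update⁻ {e} = subst₂ (Rel M) (sym (x-unchanged e)) (sym ([↦]-same ρ (suc x) e))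

    at-successor : (e : D M) (k : IFm) →
      Sat M (ST k (suc x)) (inFull (ST k (suc x))) ρ[ e ] ⇔ Forces M e k
    at-successor e k =
      subst (λ d → Sat M (ST k (suc x)) (inFull (ST k (suc x))) ρ[ e ] ⇔ Forces M d k)
        ([↦]-same ρ (suc x) e) (Sat-ST M k (suc x) ρ[ e ])

    successor : (e : D M) →
      (Sat M (ST i (suc x)) (inFull (ST i (suc x))) ρ[ e ] →
       Sat M (ST j (suc x)) (inFull (ST j (suc x))) ρ[ e ])
      ⇔ (Forces M e i → Forces M e j)
    successor e = →-cong-⇔ (at-successor e i) (at-successor e j)

Forces-asim : {M₁ M₂ : Structure FullSig}
  {A₁₂ : D M₁ → D M₂ → Set} {A₂₁ : D M₂ → D M₁ → Set} →
  AsimCond M₁ M₂ A₁₂ A₂₁ → AsimCond M₂ M₁ A₂₁ A₁₂ →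
  (i : IFm) {a : D M₁} {b : D M₂} → A₁₂ a b → Forces M₁ a i → Forces M₂ b i
Forces-asim cond₁₂ cond₂₁ (var n) {a} {b} ab p = proj₁ (cond₁₂ a b ab) n tt p
Forces-asim cond₁₂ cond₂₁ ⊥ᵢ ab ()
Forces-asim cond₁₂ cond₂₁ (i ∧ᵢ j) ab (p , q) =
  Forces-asim cond₁₂ cond₂₁ i ab p , Forces-asim cond₁₂ cond₂₁ j ab q
Forces-asim cond₁₂ cond₂₁ (i ∨ᵢ j) ab (inj₁ p) = inj₁ (Forces-asim cond₁₂ cond₂₁ i ab p)
Forces-asim cond₁₂ cond₂₁ (i ∨ᵢ j) ab (inj₂ q) = inj₂ (Forces-asim cond₁₂ cond₂₁ j ab q)
Forces-asim cond₁₂ cond₂₁ (i →ᵢ j) {a} {b} ab f b″ bRb″ p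
  with proj₂ (cond₁₂ a b ab) b″ bRb″
... | a″ , aRa″ , b″a″ , a″b″ =
  Forces-asim cond₁₂ cond₂₁ j a″b″ (f a″ aRa″ (Forces-asim cond₂₁ cond₁₂ i b″a″ p))

corollary2 : (φ : Fm) (x : Var) → OnlyFree x φ → (i : IFm) →
    LogEquiv φ (ST i x) → InvariantAsim φ x
corollary2 φ x _ i φ⇔ST S h M N a b (AMN , ANM , ab , condMN , condNM) M⊨φ ρ ρx≡b =
  Equivalence.from (φ-as-forcing N ρ) (subst (λ d → Forces (extend N) d i) (sym ρx≡b) b⊩i)
  where
    φ-as-forcing : (K : Structure S) (σ : Var → D K) →
      Sat K φ h σ ⇔ Forces (extend K) (σ x) i
    φ-as-forcing K σ =
      ⇔-trans (Sat-extend K φ h σ) (⇔-trans (φ⇔ST (extend K) σ) (Sat-ST (extend K) i x σ))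

    b⊩i : Forces (extend N) b i
    b⊩i = Forces-asim (AsimCond-extend condMN) (AsimCond-extend condNM) i ab
      (Equivalence.to (φ-as-forcing M (λ _ → a)) (M⊨φ (λ _ → a) refl))
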